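{- Let $\rho=\alpha n\beta\in S_n$, where $\alpha$ and $\beta$ are nonempty sequences. Then $\mathrm{psb}^{ -1}(\mathrm{Av}(\rho))$ is not a permutation class.
   Context: A permutation contains a pattern $\rho\in S_k$ if some length-$k$ subsequence has entries in the same relative order as $\rho$; $\mathrm{Av}(\rho)$ is the set of all permutations avoiding $\rho$. A permutation class is a set of permutations closed under taking patterns (if $\pi$ is in the set and $\sigma$ is contained in $\pi$ as a pattern, then $\sigma$ is in the set). The algorithm PSB processes $\pi=\pi_1\cdots\pi_n$ from left to right with one pop stack $S$ (initially empty; PUSH puts an element on top, POP removes all elements appending them to the output from top to bottom) and an initially empty output: for $i=1,\dots,n$, if $S$ is empty or $\pi_i=\mathrm{TOP}(S)-1$ (where $\mathrm{TOP}(S)$ is the top element of $S$), push $\pi_i$; else if $\pi_i<\mathrm{TOP}(S)-1$, append $\pi_i$ directly to the output (bypass); otherwise pop $S$ and then push $\pi_i$. After all entries are processed, pop $S$. The output is $\mathrm{psb}(\pi)$, and $\mathrm{psb}^{ -1}(\mathcal{D})=\{\pi:\mathrm{psb}(\pi)\in\mathcal{D}\}$. -}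

module Defs where

open import Data.Nat using (ℕ; zero; suc; _<_; _<ᵇ_; _≡ᵇ_)
open import Data.Bool using (if_then_else_)
open import Data.List using (List; []; _∷_; _++_; length; zip; applyUpTo)
open import Data.List.Relation.Unary.AllPairs using (AllPairs)
open import Data.List.Relation.Binary.Sublist.Propositional using (_⊆_)
open import Data.List.Relation.Binary.Permutation.Propositional using (_↭_)
open import Data.Product using (_×_; _,_; Σ)
open import Function.Bundles using (_⇔_)
open import Relation.Binary.PropositionalEquality using (_≡_)
open import Relation.Nullary using (¬_)

IsPerm : List ℕ → Set
IsPerm xs = xs ↭ applyUpTo suc (length xs)

SameOrder : ℕ × ℕ → ℕ × ℕ → Set
SameOrder (a , b) (c , d) = ((a < c) ⇔ (b < d)) × ((c < a) ⇔ (d < b))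

OrderIso : List ℕ → List ℕ → Set
OrderIso xs ys = (length xs ≡ length ys) × AllPairs SameOrder (zip xs ys)

Contains : List ℕ → List ℕ → Set
Contains π ρ = Σ (List ℕ) (λ s → (s ⊆ π) × OrderIso s ρ)

Av : List ℕ → List ℕ → Set
Av ρ π = IsPerm π × ¬ Contains π ρ

IsPermClass : (List ℕ → Set) → Set
IsPermClass C = (∀ π → C π → IsPerm π) ×
                (∀ π σ → C π → IsPerm σ → Contains π σ → C σ)

-- The algorithm PSB. The stack is a list with its top at the head;
-- popping appends the stack contents from top to bottom to the output.
psbGo : List ℕ → List ℕ → List ℕ → List ℕ
psbGo []       stack       out = out ++ stack
psbGo (x ∷ xs) []          out = psbGo xs (x ∷ []) out
psbGo (x ∷ xs) (t ∷ stack) out =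
  if suc x ≡ᵇ t then psbGo xs (x ∷ t ∷ stack) out
  else if suc x <ᵇ t then psbGo xs (t ∷ stack) (out ++ (x ∷ []))
  else psbGo xs (x ∷ []) (out ++ (t ∷ stack))

psb : List ℕ → List ℕ
psb π = psbGo π [] []

psbPre : (List ℕ → Set) → List ℕ → Set
psbPre D π = IsPerm π × D (psb π)

-- Write K = |ρ| and γ = αβ, so γ is a permutation of 1,…,K-1. The permutation
-- π = (K+1)(K+3) α (K+2) β K is mapped by PSB to (K+1) γ K (K+2)(K+3), which avoids ρ:
-- an occurrence of ρ has an entry larger than all its other entries with entries on both
-- sides, and such an entry cannot be the first one nor lie in the increasing tail
-- K (K+2)(K+3), so it lies in γ; then the whole occurrence lies in γ, which is too short.
-- Deleting K+3 from π gives σ = (K+1) α (K+2) β K, whose image α (K+1) β K (K+2)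
-- contains α (K+1) β, an occurrence of ρ. So π lies in psb⁻¹(Av ρ) but its pattern σ does not.

module Submission where

open import Defs
open import Data.Nat using (ℕ; zero; suc; _<_; _≤_; _<?_; z<s; s≤s)
open import Data.Nat.Properties
  using (≡⇒≡ᵇ; ≡ᵇ⇒≡; <⇒<ᵇ; <ᵇ⇒<; <⇒≢; >⇒≢; ≤⇒≯; <-cmp; <-asym; <-irrefl; <-trans; ≤-<-trans;
         n<1+n; n≤1+n; 1+n≰n; m<n+m; m≤n+m; m<n⇒m<1+n; m≤n⇒m≤1+n; ≤-refl; suc-injective)
open import Data.Bool using (true; false; T)
open import Data.Bool.Properties using (T-≡)
open import Data.Empty using (⊥-elim)
open import Data.Unit using (tt)
open import Data.Fin using (zero; suc)
open import Data.Vec using (Vec; []; _∷_)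
open import Data.Product using (Σ; _×_; _,_; proj₁; proj₂)
open import Data.List using (List; []; _∷_; _++_; [_]; length; map; zip; filter; applyUpTo)
open import Data.List.Properties
  using (++-assoc; ++-identityʳ; length-map; map-++; map-id; map-id-local;
         applyUpTo-∷ʳ; filter-reject; filter-++; filter-all; filter-none)
open import Data.List.Membership.Propositional using (_∈_)
open import Data.List.Relation.Unary.Any using (here; there)
open import Data.List.Relation.Unary.All using (All; []; _∷_; lookup)
import Data.List.Relation.Unary.All as All
open import Data.List.Relation.Unary.All.Properties using (++⁺; ++⁻ˡ; ++⁻ʳ)
open import Data.List.Relation.Unary.AllPairs using (AllPairs; []; _∷_)
open import Data.List.Relation.Binary.Sublist.Heterogeneous using (minimum)
open import Data.List.Relation.Binary.Sublist.Heterogeneous.Properties using (length-mono-≤)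
open import Data.List.Relation.Binary.Sublist.Propositional using (_⊆_; []; _∷_; _∷ʳ_; ⊆-refl; ⊆-trans)
open import Data.List.Relation.Binary.Sublist.Propositional.Properties
  using (All-resp-⊆; ∷⁻; ++⁺ˡ; ++⁺ʳ; filter⁺)
  renaming (++⁺ to ⊆-++⁺)
open import Data.List.Relation.Binary.Permutation.Propositional using (_↭_; ↭-sym; ↭-trans)
open import Data.List.Relation.Binary.Permutation.Propositional.Properties
  using (↭-length; ∷↭∷ʳ; drop-mid; All-resp-↭; ++-commutativeMonoid)
  renaming (++⁺ʳ to ↭-++⁺ʳ)
open import Function using (id; _∘_)
open import Function.Bundles using (mk⇔; Equivalence)
open import Relation.Binary.PropositionalEquality
  using (_≡_; _≢_; refl; sym; trans; cong; cong₂; subst; module ≡-Reasoning)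
open import Relation.Nullary using (¬_; yes; no)
open import Relation.Binary.Definitions using (tri<; tri≈; tri>)
open import Relation.Unary using (Decidable)

¬T⇒≡false : ∀ {b} → ¬ T b → b ≡ false
¬T⇒≡false {false} _  = refl
¬T⇒≡false {true}  ¬t = ⊥-elim (¬t tt)

module _ {x t : ℕ} {xs stack out : List ℕ} where

  psbGo-push : suc x ≡ t → psbGo (x ∷ xs) (t ∷ stack) out ≡ psbGo xs (x ∷ t ∷ stack) out
  psbGo-push refl rewrite Equivalence.to T-≡ (≡⇒≡ᵇ x x refl) = refl

  psbGo-bypass : suc x < t → psbGo (x ∷ xs) (t ∷ stack) out ≡ psbGo xs (t ∷ stack) (out ++ [ x ])
  psbGo-bypass x+1<t
    rewrite ¬T⇒≡false (<⇒≢ x+1<t ∘ ≡ᵇ⇒≡ (suc x) t) | Equivalence.to T-≡ (<⇒<ᵇ x+1<t) = refl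

  psbGo-pop : t ≤ x → psbGo (x ∷ xs) (t ∷ stack) out ≡ psbGo xs [ x ] (out ++ t ∷ stack)
  psbGo-pop t≤x
    rewrite ¬T⇒≡false (>⇒≢ (s≤s t≤x) ∘ ≡ᵇ⇒≡ (suc x) t)
          | ¬T⇒≡false (≤⇒≯ (m≤n⇒m≤1+n t≤x) ∘ <ᵇ⇒< (suc x) t) = refl

psbGo-bypassAll : ∀ {K t stack} xs {rest out} → All (_< K) xs → K < t →
                  psbGo (xs ++ rest) (t ∷ stack) out ≡ psbGo rest (t ∷ stack) (out ++ xs)
psbGo-bypassAll {t = t} {stack} [] {rest} {out} [] _ =
  cong (psbGo rest (t ∷ stack)) (sym (++-identityʳ out))
psbGo-bypassAll {t = t} {stack} (x ∷ xs) {rest} {out} (x<K ∷ xs<K) K<t = begin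
  psbGo (x ∷ xs ++ rest) (t ∷ stack) out          ≡⟨ psbGo-bypass {xs = xs ++ rest} (≤-<-trans x<K K<t) ⟩
  psbGo (xs ++ rest) (t ∷ stack) (out ++ [ x ])   ≡⟨ psbGo-bypassAll xs xs<K K<t ⟩
  psbGo rest (t ∷ stack) ((out ++ [ x ]) ++ xs)   ≡⟨ cong (psbGo rest (t ∷ stack)) (++-assoc out [ x ] xs) ⟩
  psbGo rest (t ∷ stack) (out ++ x ∷ xs)          ∎
  where open ≡-Reasoning

-- The two witnesses and their images under PSB

σ π : ℕ → List ℕ → List ℕ → List ℕ
σ K α β = suc K ∷ α ++ suc (suc K) ∷ β ++ [ K ]
π K α β = suc K ∷ suc (suc (suc K)) ∷ α ++ suc (suc K) ∷ β ++ [ K ]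

module _ {K : ℕ} {α β : List ℕ} (α<K : All (_< K) α) (β<K : All (_< K) β) where
  open ≡-Reasoning

  psb-σ : psb (σ K α β) ≡ α ++ suc K ∷ β ++ K ∷ suc (suc K) ∷ []
  psb-σ = begin
    psbGo (α ++ suc (suc K) ∷ β ++ [ K ]) [ suc K ] []
      ≡⟨ psbGo-bypassAll α α<K (n<1+n K) ⟩
    psbGo (suc (suc K) ∷ β ++ [ K ]) [ suc K ] α
      ≡⟨ psbGo-pop {xs = β ++ [ K ]} (n≤1+n (suc K)) ⟩
    psbGo (β ++ [ K ]) [ suc (suc K) ] (α ++ [ suc K ])
      ≡⟨ psbGo-bypassAll β β<K (m<n+m K z<s) ⟩
    psbGo [ K ] [ suc (suc K) ] ((α ++ [ suc K ]) ++ β)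
      ≡⟨ psbGo-bypass {xs = []} (n<1+n (suc K)) ⟩
    (((α ++ [ suc K ]) ++ β) ++ [ K ]) ++ [ suc (suc K) ]
      ≡⟨ ++-assoc ((α ++ [ suc K ]) ++ β) [ K ] _ ⟩
    ((α ++ [ suc K ]) ++ β) ++ K ∷ suc (suc K) ∷ []
      ≡⟨ ++-assoc (α ++ [ suc K ]) β _ ⟩
    (α ++ [ suc K ]) ++ β ++ K ∷ suc (suc K) ∷ []
      ≡⟨ ++-assoc α [ suc K ] _ ⟩
    α ++ suc K ∷ β ++ K ∷ suc (suc K) ∷ [] ∎

  psb-π : psb (π K α β) ≡ suc K ∷ (α ++ β) ++ K ∷ suc (suc K) ∷ suc (suc (suc K)) ∷ []
  psb-π = begin
    psbGo (suc (suc (suc K)) ∷ α ++ suc (suc K) ∷ β ++ [ K ]) [ suc K ] []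
      ≡⟨ psbGo-pop {xs = α ++ suc (suc K) ∷ β ++ [ K ]} (m≤n+m (suc K) 2) ⟩
    psbGo (α ++ suc (suc K) ∷ β ++ [ K ]) [ suc (suc (suc K)) ] [ suc K ]
      ≡⟨ psbGo-bypassAll α α<K (m<n+m K {3} z<s) ⟩
    psbGo (suc (suc K) ∷ β ++ [ K ]) [ suc (suc (suc K)) ] (suc K ∷ α)
      ≡⟨ psbGo-push {xs = β ++ [ K ]} refl ⟩
    psbGo (β ++ [ K ]) (suc (suc K) ∷ [ suc (suc (suc K)) ]) (suc K ∷ α)
      ≡⟨ psbGo-bypassAll β β<K (m<n+m K z<s) ⟩
    psbGo [ K ] (suc (suc K) ∷ [ suc (suc (suc K)) ]) (suc K ∷ α ++ β)
      ≡⟨ psbGo-bypass {xs = []} {stack = [ suc (suc (suc K)) ]} {out = suc K ∷ α ++ β} (n<1+n (suc K)) ⟩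
    suc K ∷ ((α ++ β) ++ [ K ]) ++ suc (suc K) ∷ suc (suc (suc K)) ∷ []
      ≡⟨ cong (suc K ∷_) (++-assoc (α ++ β) [ K ] _) ⟩
    suc K ∷ (α ++ β) ++ K ∷ suc (suc K) ∷ suc (suc (suc K)) ∷ [] ∎

length-insert : ∀ {A : Set} (xs : List A) {x} ys → length (xs ++ x ∷ ys) ≡ suc (length (xs ++ ys))
length-insert []       ys = refl
length-insert (_ ∷ xs) ys = cong suc (length-insert xs ys)

IsPerm-resp-↭ : ∀ {xs ys} → xs ↭ ys → IsPerm ys → IsPerm xs
IsPerm-resp-↭ {xs} xs↭ys ys-perm =
  subst (λ n → xs ↭ applyUpTo suc n) (sym (↭-length xs↭ys)) (↭-trans xs↭ys ys-perm)

IsPerm-push-max : ∀ {xs} → IsPerm xs → IsPerm (suc (length xs) ∷ xs)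
IsPerm-push-max {xs} xs-perm = ↭-trans (∷↭∷ʳ _ xs)
  (subst (xs ++ [ suc (length xs) ] ↭_) (applyUpTo-∷ʳ suc (length xs)) (↭-++⁺ʳ _ xs-perm))

IsPerm-drop-max : ∀ α β → IsPerm (α ++ suc (length (α ++ β)) ∷ β) → IsPerm (α ++ β)
IsPerm-drop-max α β ρ-perm = subst (α ++ β ↭_) (++-identityʳ _)
  (drop-mid α (applyUpTo suc n) (subst (α ++ suc n ∷ β ↭_) (sym (applyUpTo-∷ʳ suc n))
    (subst (λ k → α ++ suc n ∷ β ↭ applyUpTo suc k) (length-insert α β) ρ-perm)))
  where
  n : ℕ
  n = length (α ++ β)

IsPerm-bounded : ∀ {xs} → IsPerm xs → All (_< suc (length xs)) xs
IsPerm-bounded xs-perm = All-resp-↭ (↭-sym xs-perm) (bounded _)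
  where
  bounded : ∀ n → All (_< suc n) (applyUpTo suc n)
  bounded zero    = []
  bounded (suc n) = subst (All (_< suc (suc n))) (applyUpTo-∷ʳ suc n)
    (++⁺ (All.map m<n⇒m<1+n (bounded n)) (n<1+n (suc n) ∷ []))

module _ (K : ℕ) (α β : List ℕ) where
  open import Algebra.Solver.CommutativeMonoid (++-commutativeMonoid {A = ℕ})

  private
    k k₁ k₂ k₃ a b : Expr 6
    k  = var zero
    k₁ = var (suc zero)
    k₂ = var (suc (suc zero))
    k₃ = var (suc (suc (suc zero)))
    a  = var (suc (suc (suc (suc zero))))
    b  = var (suc (suc (suc (suc (suc zero)))))

    values : Vec (List ℕ) 6
    values = [ K ] ∷ [ suc K ] ∷ [ suc (suc K) ] ∷ [ suc (suc (suc K)) ] ∷ α ∷ β ∷ []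

  σ-↭ : σ K α β ↭ suc (suc K) ∷ suc K ∷ K ∷ α ++ β
  σ-↭ = prove 6 (k₁ ⊕ (a ⊕ (k₂ ⊕ (b ⊕ k)))) (k₂ ⊕ (k₁ ⊕ (k ⊕ (a ⊕ b)))) values

  π-↭ : π K α β ↭ suc (suc (suc K)) ∷ suc (suc K) ∷ suc K ∷ K ∷ α ++ β
  π-↭ = prove 6 (k₁ ⊕ (k₃ ⊕ (a ⊕ (k₂ ⊕ (b ⊕ k))))) (k₃ ⊕ (k₂ ⊕ (k₁ ⊕ (k ⊕ (a ⊕ b))))) values

  psb-π-↭ : suc K ∷ (α ++ β) ++ K ∷ suc (suc K) ∷ suc (suc (suc K)) ∷ [] ↭
            suc (suc (suc K)) ∷ suc (suc K) ∷ suc K ∷ K ∷ α ++ β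
  psb-π-↭ = prove 6 (k₁ ⊕ ((a ⊕ b) ⊕ (k ⊕ (k₂ ⊕ k₃)))) (k₃ ⊕ (k₂ ⊕ (k₁ ⊕ (k ⊕ (a ⊕ b))))) values

orderIso-map : ∀ {f : ℕ → ℕ} → (∀ {m n} → m < n → f m < f n) → ∀ xs → OrderIso (map f xs) xs
orderIso-map {f} f-mono xs = length-map f xs , pairs xs
  where
  f-reflects : ∀ {m n} → f m < f n → m < n
  f-reflects {m} {n} fm<fn with <-cmp m n
  ... | tri< m<n _ _  = m<n
  ... | tri≈ _ refl _ = ⊥-elim (<-irrefl refl fm<fn)
  ... | tri> _ _ n<m  = ⊥-elim (<-asym fm<fn (f-mono n<m))

  sameOrder : ∀ {x} ys → All (SameOrder (f x , x)) (zip (map f ys) ys)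
  sameOrder []       = []
  sameOrder (y ∷ ys) = (mk⇔ f-reflects f-mono , mk⇔ f-reflects f-mono) ∷ sameOrder ys

  pairs : ∀ ys → AllPairs SameOrder (zip (map f ys) ys)
  pairs []       = []
  pairs (y ∷ ys) = sameOrder ys ∷ pairs ys

orderIso-refl : ∀ xs → OrderIso xs xs
orderIso-refl xs = subst (λ ys → OrderIso ys xs) (map-id xs) (orderIso-map id xs)

bumpFrom : ℕ → ℕ → ℕ
bumpFrom K v with v <? K
... | yes _ = v
... | no  _ = suc v

bumpFrom-mono : ∀ {K m n} → m < n → bumpFrom K m < bumpFrom K n
bumpFrom-mono {K} {m} {n} m<n with m <? K | n <? K
... | yes _   | yes _   = m<n
... | yes _   | no  _   = m<n⇒m<1+n m<n
... | no  m≮K | yes n<K = ⊥-elim (m≮K (<-trans m<n n<K))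
... | no  _   | no  _   = s≤s m<n

bumpFrom-below : ∀ {K v} → v < K → bumpFrom K v ≡ v
bumpFrom-below {K} {v} v<K with v <? K
... | yes _   = refl
... | no  v≮K = ⊥-elim (v≮K v<K)

bumpFrom-self : ∀ K → bumpFrom K K ≡ suc K
bumpFrom-self K with K <? K
... | yes K<K = ⊥-elim (<-irrefl refl K<K)
... | no  _   = refl

orderIso-raise : ∀ {K} α β → All (_< K) α → All (_< K) β → OrderIso (α ++ suc K ∷ β) (α ++ K ∷ β)
orderIso-raise {K} α β α<K β<K =
  subst (λ s → OrderIso s (α ++ K ∷ β)) raised (orderIso-map bumpFrom-mono (α ++ K ∷ β))
  where
  raised : map (bumpFrom K) (α ++ K ∷ β) ≡ α ++ suc K ∷ β
  raised = trans (map-++ (bumpFrom K) α (K ∷ β))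
    (cong₂ _++_ (map-id-local (All.map bumpFrom-below α<K))
                (cong₂ _∷_ (bumpFrom-self K) (map-id-local (All.map bumpFrom-below β<K))))

-- Occurrences of α K β

record PeakSplit (s α : List ℕ) (K : ℕ) (β : List ℕ) : Set where
  field
    before        : List ℕ
    peak          : ℕ
    after         : List ℕ
    split         : s ≡ before ++ peak ∷ after
    length-before : length before ≡ length α
    length-after  : length after ≡ length β
    paired        : (peak , K) ∈ zip s (α ++ K ∷ β)
    before<peak   : All (_< peak) before
    after<peak    : All (_< peak) after

below-peak : ∀ {m K} ys bs → length ys ≡ length bs → All (_< K) bs →
             All (SameOrder (m , K)) (zip ys bs) → All (_< m) ys
below-peak []       []       _   _            _        = []
below-peak (y ∷ ys) (b ∷ bs) len (b<K ∷ bs<K) (o ∷ os) =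
  Equivalence.from (proj₂ o) b<K ∷ below-peak ys bs (suc-injective len) bs<K os

peakSplit : ∀ {K β} α {s} → OrderIso s (α ++ K ∷ β) → All (_< K) α → All (_< K) β → PeakSplit s α K β
peakSplit []      {m ∷ sβ} (len , o ∷ _) [] β<K = record
  { before = []; peak = m; after = sβ; split = refl
  ; length-before = refl; length-after = suc-injective len; paired = here refl
  ; before<peak = []; after<peak = below-peak sβ _ (suc-injective len) β<K o }
peakSplit (a ∷ α) {x ∷ s}  (len , o ∷ os) (a<K ∷ α<K) β<K = record
  { before = x ∷ before; peak = peak; after = after; split = cong (x ∷_) split
  ; length-before = cong suc length-before; length-after = length-after; paired = there paired
  ; before<peak = Equivalence.from (proj₁ (lookup o paired)) a<K ∷ before<peak
  ; after<peak = after<peak }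
  where open PeakSplit (peakSplit α (suc-injective len , os) α<K β<K)

descent-in-prefix : ∀ {m y} γ {D} → m ∷ y ∷ [] ⊆ γ ++ D → AllPairs _<_ D → y < m → m ∈ γ
descent-in-prefix []      (_ ∷ʳ p)   (_ ∷ D↑)  y<m = descent-in-prefix [] p D↑ y<m
descent-in-prefix []      (refl ∷ p) (m<D ∷ _) y<m = ⊥-elim (<-asym y<m (All.head (All-resp-⊆ p m<D)))
descent-in-prefix (_ ∷ γ) (_ ∷ʳ p)   D↑        y<m = there (descent-in-prefix γ p D↑ y<m)
descent-in-prefix (_ ∷ γ) (refl ∷ _) _         _   = here refl

inner-descent : ∀ {w m zs} bs cs → bs ++ m ∷ cs ⊆ w ∷ zs → bs ≢ [] → cs ≢ [] → All (_< m) cs →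
                Σ ℕ λ y → y < m × m ∷ y ∷ [] ⊆ zs
inner-descent []       _        _ bs≢[] _     _           = ⊥-elim (bs≢[] refl)
inner-descent (_ ∷ _)  []       _ _     cs≢[] _           = ⊥-elim (cs≢[] refl)
inner-descent (_ ∷ bs) (y ∷ cs) p _     _     (y<m ∷ _) =
  y , y<m , ⊆-trans (++⁺ˡ bs (refl ∷ refl ∷ minimum cs)) (∷⁻ p)

length-≤-filter : ∀ {A : Set} {P : A → Set} (P? : Decidable P) {s xs} →
                  s ⊆ xs → All P s → length s ≤ length (filter P? xs)
length-≤-filter P? s⊆xs Ps = subst (λ t → length t ≤ _) (filter-all P? Ps)
  (length-mono-≤ (filter⁺ P? P? (λ { refl p → p }) s⊆xs))

≢[]-resp-length : ∀ {A : Set} {xs ys : List A} → length xs ≡ length ys → ys ≢ [] → xs ≢ []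
≢[]-resp-length {ys = []}    _  ys≢[] _    = ys≢[] refl
≢[]-resp-length {ys = _ ∷ _} () _     refl

psb-π-avoids : ∀ {K} α β → α ≢ [] → β ≢ [] → All (_< K) α → All (_< K) β →
               ¬ Contains (suc K ∷ (α ++ β) ++ K ∷ suc (suc K) ∷ suc (suc (suc K)) ∷ []) (α ++ K ∷ β)
psb-π-avoids {K} α β α≢[] β≢[] α<K β<K (s , s⊆τ , iso) =
  1+n≰n (subst (_≤ length γ) (trans (proj₁ iso) (length-insert α β)) s-fits-γ)
  where
  open PeakSplit (peakSplit α iso α<K β<K)
  γ D : List ℕ
  γ = α ++ β
  D = K ∷ suc (suc K) ∷ suc (suc (suc K)) ∷ []

  γ<K : All (_< K) γ
  γ<K = ++⁺ α<K β<K

  D-increasing : AllPairs _<_ D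
  D-increasing = (m<n+m K {2} z<s ∷ m<n+m K {3} z<s ∷ []) ∷ (n<1+n (suc (suc K)) ∷ []) ∷ [] ∷ []

  peak<K : peak < K
  peak<K with inner-descent before after (subst (_⊆ _) split s⊆τ)
                (≢[]-resp-length length-before α≢[]) (≢[]-resp-length length-after β≢[]) after<peak
  ... | y , y<peak , descent = lookup γ<K (descent-in-prefix γ descent D-increasing y<peak)

  s<K : All (_< K) s
  s<K = subst (All (_< K)) (sym split)
    (++⁺ (All.map (λ x<m → <-trans x<m peak<K) before<peak)
         (peak<K ∷ All.map (λ x<m → <-trans x<m peak<K) after<peak))

  filter-τ : filter (_<? K) (suc K ∷ γ ++ D) ≡ γ
  filter-τ = begin
    filter (_<? K) (suc K ∷ γ ++ D)          ≡⟨ filter-reject (_<? K) (≤⇒≯ (n≤1+n K)) ⟩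
    filter (_<? K) (γ ++ D)                  ≡⟨ filter-++ (_<? K) γ D ⟩
    filter (_<? K) γ ++ filter (_<? K) D     ≡⟨ cong₂ _++_ (filter-all (_<? K) γ<K) (filter-none (_<? K) D≮K) ⟩
    γ ++ []                                  ≡⟨ ++-identityʳ γ ⟩
    γ                                        ∎
    where
    open ≡-Reasoning
    D≮K : All (λ d → ¬ d < K) D
    D≮K = ≤⇒≯ ≤-refl ∷ ≤⇒≯ (m≤n+m K 2) ∷ ≤⇒≯ (m≤n+m K 3) ∷ []

  s-fits-γ : length s ≤ length γ
  s-fits-γ = subst (λ t → length s ≤ length t) filter-τ (length-≤-filter (_<? K) s⊆τ s<K)

psbPre-Av-notClass : ∀ α β → α ≢ [] → β ≢ [] → IsPerm (α ++ β) →
                     ¬ IsPermClass (psbPre (Av (α ++ suc (length (α ++ β)) ∷ β)))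
psbPre-Av-notClass α β α≢[] β≢[] γ-perm (_ , closed) = proj₂ (proj₂ σ-in) psb-σ-contains-ρ
  where
  K : ℕ
  K = suc (length (α ++ β))
  ρ : List ℕ
  ρ = α ++ K ∷ β

  α<K : All (_< K) α
  α<K = ++⁻ˡ α (IsPerm-bounded γ-perm)
  β<K : All (_< K) β
  β<K = ++⁻ʳ α (IsPerm-bounded γ-perm)

  σ-sorted-perm : IsPerm (suc (suc K) ∷ suc K ∷ K ∷ α ++ β)
  σ-sorted-perm = IsPerm-push-max (IsPerm-push-max (IsPerm-push-max γ-perm))
  π-sorted-perm : IsPerm (suc (suc (suc K)) ∷ suc (suc K) ∷ suc K ∷ K ∷ α ++ β)
  π-sorted-perm = IsPerm-push-max σ-sorted-perm

  π-in : psbPre (Av ρ) (π K α β)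
  π-in = IsPerm-resp-↭ (π-↭ K α β) π-sorted-perm
       , subst (λ τ → IsPerm τ × ¬ Contains τ ρ) (sym (psb-π α<K β<K))
           (IsPerm-resp-↭ (psb-π-↭ K α β) π-sorted-perm , psb-π-avoids α β α≢[] β≢[] α<K β<K)

  σ-in : psbPre (Av ρ) (σ K α β)
  σ-in = closed (π K α β) (σ K α β) π-in (IsPerm-resp-↭ (σ-↭ K α β) σ-sorted-perm)
    (σ K α β , refl ∷ (_ ∷ʳ ⊆-refl) , orderIso-refl _)

  psb-σ-contains-ρ : Contains (psb (σ K α β)) ρ
  psb-σ-contains-ρ = α ++ suc K ∷ β
    , subst (α ++ suc K ∷ β ⊆_) (sym (psb-σ α<K β<K)) (⊆-++⁺ ⊆-refl (refl ∷ ++⁺ʳ _ ⊆-refl))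
    , orderIso-raise α β α<K β<K

mainTheorem9 : (ρ α β : List ℕ) → IsPerm ρ → α ≢ [] → β ≢ [] →
               ρ ≡ α ++ (length ρ ∷ β) →
               ¬ IsPermClass (psbPre (Av ρ))
mainTheorem9 ρ α β ρ-perm α≢[] β≢[] ρ≡ =
  subst (λ r → ¬ IsPermClass (psbPre (Av r))) (sym ρ≡′)
    (psbPre-Av-notClass α β α≢[] β≢[] (IsPerm-drop-max α β (subst IsPerm ρ≡′ ρ-perm)))
  where
  ρ≡′ : ρ ≡ α ++ suc (length (α ++ β)) ∷ β
  ρ≡′ = trans ρ≡ (cong (λ k → α ++ k ∷ β) (trans (cong length ρ≡) (length-insert α β)))
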